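{- Let $G$ and $H$ be connected graphs of order at least $3$. If $G \times H$ is well-dominated, then $\gamma(G \times H)=\gamma(G)\,n(H)=\gamma(H)\,n(G)$. Furthermore, $\gamma(G)=\alpha(G)$ and $\gamma(H)=\alpha(H)$.
   Context: All graphs are finite, simple and undirected; $n(X)$ is the order of $X$. $\gamma(X)$ is the minimum size of a dominating set (a set $D$ such that every vertex is in $D$ or adjacent to a vertex of $D$), $\Gamma(X)$ the maximum size of a minimal dominating set, and $\alpha(X)$ the maximum size of an independent set. $X$ is well-dominated if $\gamma(X)=\Gamma(X)$. The direct product $G\times H$ has vertex set $V(G)\times V(H)$, with $(g_1,h_1)\sim(g_2,h_2)$ iff $g_1g_2\in E(G)$ and $h_1h_2\in E(H)$. -}

module Defs where

open import Data.Nat using (ℕ; _*_; _≤_)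
open import Data.Bool using (Bool; T; _∧_)
open import Data.Fin using (Fin; remQuot)
open import Data.Fin.Subset using (Subset; _∈_; _⊆_; ∣_∣)
open import Data.Product using (Σ; ∃; _×_; _,_; proj₁; proj₂)
open import Data.Sum using (_⊎_)
open import Relation.Nullary using (¬_)
open import Relation.Binary.PropositionalEquality using (_≡_)

record Graph : Set where
  field
    n     : ℕ
    adj   : Fin n → Fin n → Bool
    sym   : ∀ u v → adj u v ≡ adj v u
    irrefl : ∀ v → adj v v ≡ Data.Bool.false

open Graph public

order : Graph → ℕ
order X = n X

Adj : (X : Graph) → Fin (n X) → Fin (n X) → Set
Adj X u v = T (adj X u v)

data Reach (X : Graph) : Fin (n X) → Fin (n X) → Set where
  here : ∀ {u} → Reach X u u
  step : ∀ {u v w} → Adj X u v → Reach X v w → Reach X u w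

Connected : Graph → Set
Connected X = ∀ u v → Reach X u v

Dominating : (X : Graph) → Subset (n X) → Set
Dominating X D = ∀ v → v ∈ D ⊎ Σ (Fin (n X)) (λ u → u ∈ D × Adj X u v)

MinimalDominating : (X : Graph) → Subset (n X) → Set
MinimalDominating X D =
  Dominating X D × (∀ D' → D' ⊆ D → Dominating X D' → D ⊆ D')

Independent : (X : Graph) → Subset (n X) → Set
Independent X S = ∀ u v → u ∈ S → v ∈ S → ¬ Adj X u v

IsGamma : Graph → ℕ → Set
IsGamma X k = Σ (Subset (n X)) (λ D → Dominating X D × ∣ D ∣ ≡ k)
            × (∀ D → Dominating X D → k ≤ ∣ D ∣)

IsUpperGamma : Graph → ℕ → Set
IsUpperGamma X k = Σ (Subset (n X)) (λ D → MinimalDominating X D × ∣ D ∣ ≡ k)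
                 × (∀ D → MinimalDominating X D → ∣ D ∣ ≤ k)

IsAlpha : Graph → ℕ → Set
IsAlpha X k = Σ (Subset (n X)) (λ S → Independent X S × ∣ S ∣ ≡ k)
            × (∀ S → Independent X S → ∣ S ∣ ≤ k)

WellDominated : Graph → Set
WellDominated X = Σ ℕ (λ k → IsGamma X k × IsUpperGamma X k)

productAdj : (G H : Graph) → Fin (n G * n H) → Fin (n G * n H) → Bool
productAdj G H x y =
  adj G (proj₁ (remQuot {n G} (n H) x)) (proj₁ (remQuot {n G} (n H) y))
  ∧ adj H (proj₂ (remQuot {n G} (n H) x)) (proj₂ (remQuot {n G} (n H) y))

private
  open import Relation.Binary.PropositionalEquality using (cong₂; cong)

  productSym : (G H : Graph) → ∀ x y → productAdj G H x y ≡ productAdj G H y x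
  productSym G H x y =
    cong₂ _∧_ (sym G (proj₁ (remQuot {n G} (n H) x)) (proj₁ (remQuot {n G} (n H) y)))
              (sym H (proj₂ (remQuot {n G} (n H) x)) (proj₂ (remQuot {n G} (n H) y)))

  productIrrefl : (G H : Graph) → ∀ x → productAdj G H x x ≡ Data.Bool.false
  productIrrefl G H x =
    cong (_∧ adj H (proj₂ (remQuot {n G} (n H) x)) (proj₂ (remQuot {n G} (n H) x)))
         (irrefl G (proj₁ (remQuot {n G} (n H) x)))

_×ᵍ_ : Graph → Graph → Graph
G ×ᵍ H = record
  { n = n G * n H
  ; adj = productAdj G H
  ; sym = productSym G H
  ; irrefl = productIrrefl G H
  }

-- Let S be a maximum independent set of G. Maximality makes S dominating, so γ(G) ≤ α(G), and
-- S × V(H) is an independent dominating set of G × H (H has no isolated vertex), hence a minimal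
-- dominating set; well-domination then gives α(G) n(H) ≤ Γ(G × H) = γ(G × H). On the other hand,
-- D × V(H) dominates G × H for every dominating set D of G, so γ(G × H) ≤ γ(G) n(H) ≤ α(G) n(H),
-- and all these quantities coincide. The same argument applies with the factors exchanged.
module Submission where

open import Defs
open import Data.Bool using (true; false; _∧_; T)
open import Data.Bool.Properties using (T-∧)
open import Data.Empty using (⊥-elim)
open import Data.Fin using (Fin; zero; suc; combine; quotient; remainder)
open import Data.Fin.Properties using (any?; remQuot-combine; combine-remQuot)
open import Data.Fin.Subset using (Subset; inside; outside; _∈_; _⊂_; _∪_; ⁅_⁆; ⊤; ⊥; ∣_∣)
open import Data.Fin.Subset.Properties
  using (_∈?_; ∈⊤; ∣⊥∣≡0; ∣⊤∣≡n; x∈⁅x⁆; x∈⁅y⁆⇒x≡y; p⊆p∪q; x∈p∪q⁺; x∈p∪q⁻; p⊂q⇒∣p∣<∣q∣)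
open import Data.Nat using (ℕ; _*_; _+_; _≤_; NonZero; >-nonZero; s≤s; z≤n)
open import Data.Nat.Properties using (≤-antisym; ≤-trans; <-trans; <⇒≤; <⇒≱; *-cancelʳ-≤; *-comm)
open import Data.Product using (_×_; ∃; _,_; proj₁; proj₂)
open import Data.Sum using (_⊎_; inj₁; inj₂; [_,_]′; map₂)
open import Data.Vec using ([]; _∷_; _++_; lookup)
open import Data.Vec.Properties using (lookup-++ˡ; lookup-++ʳ; lookup-replicate; []=⇒lookup; lookup⇒[]=)
open import Function.Bundles using (Equivalence)
open import Relation.Binary.PropositionalEquality
  using (_≡_; _≢_; refl; trans; cong; cong₂; subst) renaming (sym to ≡-sym)
open import Relation.Nullary using (¬_; yes; no; contradiction)
open import Relation.Nullary.Decidable using (T?; _×-dec_)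

Adj-sym : (X : Graph) {u v : Fin (n X)} → Adj X u v → Adj X v u
Adj-sym X {u} {v} = subst T (Graph.sym X u v)

NoIsolatedVertex : Graph → Set
NoIsolatedVertex X = ∀ v → ∃ (Adj X v)

∃-distinct : ∀ {m} → 2 ≤ m → (v : Fin m) → ∃ (v ≢_)
∃-distinct (s≤s (s≤s z≤n)) zero    = suc zero , λ ()
∃-distinct (s≤s (s≤s z≤n)) (suc v) = zero , λ ()

Reach-distinct⇒∃Adj : (X : Graph) {u v : Fin (n X)} → Reach X u v → u ≢ v → ∃ (Adj X u)
Reach-distinct⇒∃Adj X here           u≢u = contradiction refl u≢u
Reach-distinct⇒∃Adj X (step u~w _)   _   = _ , u~w

connected⇒noIsolatedVertex : (X : Graph) → Connected X → 2 ≤ order X → NoIsolatedVertex X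
connected⇒noIsolatedVertex X connected 2≤n v =
  let w , v≢w = ∃-distinct 2≤n v in Reach-distinct⇒∃Adj X (connected v w) v≢w

independent∧dominating⇒minimal : (X : Graph) {D : Subset (n X)} →
  Independent X D → Dominating X D → MinimalDominating X D
independent∧dominating⇒minimal X {D} independent dominating =
  dominating , λ D′ D′⊆D dominating′ {v} v∈D →
    [ (λ v∈D′ → v∈D′)
    , (λ { (u , u∈D′ , u~v) → ⊥-elim (independent u v (D′⊆D u∈D′) v∈D u~v) })
    ]′ (dominating′ v)

∈-∪⁅⁆⁻ : ∀ {m} {x v : Fin m} (S : Subset m) → x ∈ S ∪ ⁅ v ⁆ → x ∈ S ⊎ x ≡ v
∈-∪⁅⁆⁻ {v = v} S x∈ = map₂ (x∈⁅y⁆⇒x≡y v) (x∈p∪q⁻ S ⁅ v ⁆ x∈)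

independent-∪⁅⁆ : (X : Graph) {S : Subset (n X)} {v : Fin (n X)} → Independent X S →
  (∀ u → u ∈ S → ¬ Adj X u v) → Independent X (S ∪ ⁅ v ⁆)
independent-∪⁅⁆ X {S} {v} independent v-free x y x∈ y∈ with ∈-∪⁅⁆⁻ S x∈ | ∈-∪⁅⁆⁻ S y∈
... | inj₁ x∈S | inj₁ y∈S = independent x y x∈S y∈S
... | inj₁ x∈S | inj₂ refl = v-free x x∈S
... | inj₂ refl | inj₁ y∈S = λ v~y → v-free y y∈S (Adj-sym X v~y)
... | inj₂ refl | inj₂ refl = subst T (irrefl X v)

maximumIndependent⇒dominating : (X : Graph) {S : Subset (n X)} → Independent X S →
  (∀ S′ → Independent X S′ → ∣ S′ ∣ ≤ ∣ S ∣) → Dominating X S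
maximumIndependent⇒dominating X {S} independent maximum v with v ∈? S
... | yes v∈S = inj₁ v∈S
... | no v∉S with any? (λ u → (u ∈? S) ×-dec T? (adj X u v))
...   | yes dominator = inj₂ dominator
...   | no undominated = contradiction (maximum (S ∪ ⁅ v ⁆) independent′) (<⇒≱ (p⊂q⇒∣p∣<∣q∣ S⊂S∪v))
  where
  independent′ : Independent X (S ∪ ⁅ v ⁆)
  independent′ = independent-∪⁅⁆ X independent (λ u u∈S u~v → undominated (u , u∈S , u~v))
  S⊂S∪v : S ⊂ S ∪ ⁅ v ⁆
  S⊂S∪v = p⊆p∪q ⁅ v ⁆ , v , x∈p∪q⁺ (inj₂ (x∈⁅x⁆ v)) , v∉S

γ≤α : (X : Graph) {γ α : ℕ} → IsGamma X γ → IsAlpha X α → γ ≤ α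
γ≤α X (_ , γ-minimum) ((S , independent , refl) , α-maximum) =
  γ-minimum S (maximumIndependent⇒dominating X independent α-maximum)

IsGamma-unique : (X : Graph) {γ γ′ : ℕ} → IsGamma X γ → IsGamma X γ′ → γ ≡ γ′
IsGamma-unique X ((D , dominating , refl) , γ-minimum) ((D′ , dominating′ , refl) , γ′-minimum) =
  ≤-antisym (γ-minimum D′ dominating′) (γ′-minimum D dominating)

wellDominated⇒minimal≤γ : (X : Graph) {γ : ℕ} {D : Subset (n X)} →
  WellDominated X → IsGamma X γ → MinimalDominating X D → ∣ D ∣ ≤ γ
wellDominated⇒minimal≤γ X {D = D} (k , isγk , (_ , Γ-maximum)) isγ minimal =
  subst (∣ D ∣ ≤_) (IsGamma-unique X isγk isγ) (Γ-maximum D minimal)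

-- A ⊠ B is the subset A × B of Fin m × Fin k, transported to Fin (m * k) along `combine`.

infixr 7 _⊠_
_⊠_ : ∀ {m k} → Subset m → Subset k → Subset (m * k)
[]            ⊠ B = []
(outside ∷ A) ⊠ B = ⊥ ++ A ⊠ B
(inside ∷ A)  ⊠ B = B ++ A ⊠ B

∣p++q∣≡∣p∣+∣q∣ : ∀ {m k} (p : Subset m) (q : Subset k) → ∣ p ++ q ∣ ≡ ∣ p ∣ + ∣ q ∣
∣p++q∣≡∣p∣+∣q∣ []            q = refl
∣p++q∣≡∣p∣+∣q∣ (outside ∷ p) q = ∣p++q∣≡∣p∣+∣q∣ p q
∣p++q∣≡∣p∣+∣q∣ (inside ∷ p)  q = cong (1 +_) (∣p++q∣≡∣p∣+∣q∣ p q)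

∣A⊠B∣≡∣A∣*∣B∣ : ∀ {m k} (A : Subset m) (B : Subset k) → ∣ A ⊠ B ∣ ≡ ∣ A ∣ * ∣ B ∣
∣A⊠B∣≡∣A∣*∣B∣ []                B = refl
∣A⊠B∣≡∣A∣*∣B∣ {k = k} (outside ∷ A) B =
  trans (∣p++q∣≡∣p∣+∣q∣ (⊥ {k}) (A ⊠ B)) (cong₂ _+_ (∣⊥∣≡0 k) (∣A⊠B∣≡∣A∣*∣B∣ A B))
∣A⊠B∣≡∣A∣*∣B∣ (inside ∷ A)  B =
  trans (∣p++q∣≡∣p∣+∣q∣ B (A ⊠ B)) (cong (∣ B ∣ +_) (∣A⊠B∣≡∣A∣*∣B∣ A B))

lookup-⊠-combine : ∀ {m k} (A : Subset m) (B : Subset k) i j →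
  lookup (A ⊠ B) (combine i j) ≡ lookup A i ∧ lookup B j
lookup-⊠-combine {k = k} (outside ∷ A) B zero j =
  trans (lookup-++ˡ (⊥ {k}) (A ⊠ B) j) (lookup-replicate j outside)
lookup-⊠-combine (inside ∷ A)  B zero j = lookup-++ˡ B (A ⊠ B) j
lookup-⊠-combine {k = k} (outside ∷ A) B (suc i) j =
  trans (lookup-++ʳ (⊥ {k}) (A ⊠ B) (combine i j)) (lookup-⊠-combine A B i j)
lookup-⊠-combine (inside ∷ A)  B (suc i) j =
  trans (lookup-++ʳ B (A ⊠ B) (combine i j)) (lookup-⊠-combine A B i j)

∈-⊠⁺ : ∀ {m k} {A : Subset m} {B : Subset k} {i j} → i ∈ A → j ∈ B → combine i j ∈ A ⊠ B
∈-⊠⁺ {A = A} {B} {i} {j} i∈A j∈B = lookup⇒[]= (combine i j) (A ⊠ B)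
  (trans (lookup-⊠-combine A B i j) (cong₂ _∧_ ([]=⇒lookup i∈A) ([]=⇒lookup j∈B)))

∈-⊠⁻ : ∀ {m k} {A : Subset m} {B : Subset k} {x} →
  x ∈ A ⊠ B → quotient {m} k x ∈ A × remainder {m} k x ∈ B
∈-⊠⁻ {m} {k} {A} {B} {x} x∈ = ∧-inside⁻ (trans (≡-sym (lookup-⊠-combine A B i j)) lookup≡inside)
  where
  i = quotient {m} k x
  j = remainder {m} k x
  lookup≡inside : lookup (A ⊠ B) (combine i j) ≡ inside
  lookup≡inside =
    subst (λ y → lookup (A ⊠ B) y ≡ inside) (≡-sym (combine-remQuot {m} k x)) ([]=⇒lookup x∈)
  ∧-inside⁻ : lookup A i ∧ lookup B j ≡ inside → i ∈ A × j ∈ B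
  ∧-inside⁻ both with lookup A i in eqA | lookup B j in eqB
  ∧-inside⁻ refl | true | true = lookup⇒[]= i A eqA , lookup⇒[]= j B eqB

module _ (G H : Graph) where

  private
    P = G ×ᵍ H
    π₁ : Fin (n P) → Fin (n G)
    π₁ = quotient {n G} (n H)
    π₂ : Fin (n P) → Fin (n H)
    π₂ = remainder {n G} (n H)

  Adj-×⁻ : ∀ {x y} → Adj P x y → Adj G (π₁ x) (π₁ y) × Adj H (π₂ x) (π₂ y)
  Adj-×⁻ = Equivalence.to T-∧

  Adj-combine-× : ∀ {g h x} → Adj G g (π₁ x) → Adj H h (π₂ x) → Adj P (combine g h) x
  Adj-combine-× {g} {h} {x} g~ h~ = Equivalence.from T-∧
    ( subst (λ gh → Adj G (proj₁ gh) (π₁ x)) (≡-sym (remQuot-combine g h)) g~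
    , subst (λ gh → Adj H (proj₂ gh) (π₂ x)) (≡-sym (remQuot-combine g h)) h~ )

  ∈-⊠⁺-remQuot : ∀ {A B x} → π₁ x ∈ A → π₂ x ∈ B → x ∈ A ⊠ B
  ∈-⊠⁺-remQuot {A} {B} {x} π₁x∈A π₂x∈B =
    subst (_∈ A ⊠ B) (combine-remQuot {n G} (n H) x) (∈-⊠⁺ {n G} π₁x∈A π₂x∈B)

  ⊠⊤-dominating : ∀ {A} → NoIsolatedVertex H → Dominating G A → Dominating P (A ⊠ ⊤)
  ⊠⊤-dominating {A} noIsolated dominating x with dominating (π₁ x) | noIsolated (π₂ x)
  ... | inj₁ π₁x∈A | _ = inj₁ (∈-⊠⁺-remQuot π₁x∈A ∈⊤)
  ... | inj₂ (g , g∈A , g~π₁x) | h , π₂x~h =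
    inj₂ (combine g h , ∈-⊠⁺ {n G} g∈A ∈⊤ , Adj-combine-× g~π₁x (Adj-sym H π₂x~h))

  ⊤⊠-dominating : ∀ {B} → NoIsolatedVertex G → Dominating H B → Dominating P (⊤ {n G} ⊠ B)
  ⊤⊠-dominating {B} noIsolated dominating x with dominating (π₂ x) | noIsolated (π₁ x)
  ... | inj₁ π₂x∈B | _ = inj₁ (∈-⊠⁺-remQuot ∈⊤ π₂x∈B)
  ... | inj₂ (h , h∈B , h~π₂x) | g , π₁x~g =
    inj₂ (combine g h , ∈-⊠⁺ {n G} ∈⊤ h∈B , Adj-combine-× (Adj-sym G π₁x~g) h~π₂x)

  ⊠-independentˡ : {A : Subset (n G)} {B : Subset (n H)} →
    Independent G A → Independent P (A ⊠ B)
  ⊠-independentˡ {A} {B} independent x y x∈ y∈ x~y =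
    independent (π₁ x) (π₁ y)
      (proj₁ (∈-⊠⁻ {A = A} {B} x∈)) (proj₁ (∈-⊠⁻ {A = A} {B} y∈)) (proj₁ (Adj-×⁻ x~y))

  ⊠-independentʳ : {A : Subset (n G)} {B : Subset (n H)} →
    Independent H B → Independent P (A ⊠ B)
  ⊠-independentʳ {A} {B} independent x y x∈ y∈ x~y =
    independent (π₂ x) (π₂ y)
      (proj₂ (∈-⊠⁻ {A = A} {B} x∈)) (proj₂ (∈-⊠⁻ {A = A} {B} y∈)) (proj₂ (Adj-×⁻ x~y))

  ∣A⊠⊤∣≡∣A∣*n : (A : Subset (n G)) → ∣ A ⊠ ⊤ ∣ ≡ ∣ A ∣ * n H
  ∣A⊠⊤∣≡∣A∣*n A = trans (∣A⊠B∣≡∣A∣*∣B∣ A (⊤ {n H})) (cong (∣ A ∣ *_) (∣⊤∣≡n (n H)))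

  ∣⊤⊠B∣≡n*∣B∣ : (B : Subset (n H)) → ∣ ⊤ {n G} ⊠ B ∣ ≡ n G * ∣ B ∣
  ∣⊤⊠B∣≡n*∣B∣ B = trans (∣A⊠B∣≡∣A∣*∣B∣ (⊤ {n G}) B) (cong (_* ∣ B ∣) (∣⊤∣≡n (n G)))

  γ×≤γ*n : {t γ : ℕ} → NoIsolatedVertex H → IsGamma P t → IsGamma G γ → t ≤ γ * n H
  γ×≤γ*n {t} noIsolated (_ , t-minimum) ((D , dominating , refl) , _) =
    subst (t ≤_) (∣A⊠⊤∣≡∣A∣*n D) (t-minimum (D ⊠ ⊤) (⊠⊤-dominating noIsolated dominating))

  γ×≤n*γ : {t γ : ℕ} → NoIsolatedVertex G → IsGamma P t → IsGamma H γ → t ≤ n G * γ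
  γ×≤n*γ {t} noIsolated (_ , t-minimum) ((D , dominating , refl) , _) =
    subst (t ≤_) (∣⊤⊠B∣≡n*∣B∣ D) (t-minimum (⊤ {n G} ⊠ D) (⊤⊠-dominating noIsolated dominating))

  α*n≤γ× : {t α : ℕ} → WellDominated P → NoIsolatedVertex H → IsGamma P t → IsAlpha G α →
    α * n H ≤ t
  α*n≤γ× {t} wellDominated noIsolated t-gamma ((S , independent , refl) , α-maximum) =
    subst (_≤ t) (∣A⊠⊤∣≡∣A∣*n S) (wellDominated⇒minimal≤γ P wellDominated t-gamma
      (independent∧dominating⇒minimal P (⊠-independentˡ independent)
        (⊠⊤-dominating noIsolated (maximumIndependent⇒dominating G independent α-maximum))))

  n*α≤γ× : {t α : ℕ} → WellDominated P → NoIsolatedVertex G → IsGamma P t → IsAlpha H α →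
    n G * α ≤ t
  n*α≤γ× {t} wellDominated noIsolated t-gamma ((S , independent , refl) , α-maximum) =
    subst (_≤ t) (∣⊤⊠B∣≡n*∣B∣ S) (wellDominated⇒minimal≤γ P wellDominated t-gamma
      (independent∧dominating⇒minimal P (⊠-independentʳ {⊤} independent)
        (⊤⊠-dominating noIsolated (maximumIndependent⇒dominating H independent α-maximum))))

squeeze : {γ α t m : ℕ} .{{_ : NonZero m}} → γ ≤ α → α * m ≤ t → t ≤ γ * m → t ≡ γ * m × γ ≡ α
squeeze {γ} {α} {t} {m} γ≤α α*m≤t t≤γ*m =
  ≤-antisym t≤γ*m (subst (λ a → a * m ≤ t) (≡-sym γ≡α) α*m≤t) , γ≡α
  where
  γ≡α : γ ≡ α
  γ≡α = ≤-antisym γ≤α (*-cancelʳ-≤ α γ m (≤-trans α*m≤t t≤γ*m))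

lemma2 : (G H : Graph) → Connected G → Connected H → 3 ≤ order G → 3 ≤ order H
    → WellDominated (G ×ᵍ H)
    → (γGH γG γH αG αH : ℕ)
    → IsGamma (G ×ᵍ H) γGH → IsGamma G γG → IsGamma H γH → IsAlpha G αG → IsAlpha H αH
    → (γGH ≡ γG * order H) × (γGH ≡ γH * order G) × (γG ≡ αG) × (γH ≡ αH)
lemma2 G H connectedG connectedH 3≤nG 3≤nH wellDominated γGH γG γH αG αH
       isγGH isγG isγH isαG isαH =
  proj₁ G-side , proj₁ H-side , proj₂ G-side , proj₂ H-side
  where
  noIsolatedG : NoIsolatedVertex G
  noIsolatedG = connected⇒noIsolatedVertex G connectedG (<⇒≤ 3≤nG)
  noIsolatedH : NoIsolatedVertex H
  noIsolatedH = connected⇒noIsolatedVertex H connectedH (<⇒≤ 3≤nH)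
  instance
    nonZeroG : NonZero (n G)
    nonZeroG = >-nonZero (<-trans (s≤s z≤n) 3≤nG)
    nonZeroH : NonZero (n H)
    nonZeroH = >-nonZero (<-trans (s≤s z≤n) 3≤nH)
  G-side : γGH ≡ γG * n H × γG ≡ αG
  G-side = squeeze (γ≤α G isγG isαG)
    (α*n≤γ× G H wellDominated noIsolatedH isγGH isαG) (γ×≤γ*n G H noIsolatedH isγGH isγG)
  H-side : γGH ≡ γH * n G × γH ≡ αH
  H-side = squeeze (γ≤α H isγH isαH)
    (subst (_≤ γGH) (*-comm (n G) αH) (n*α≤γ× G H wellDominated noIsolatedG isγGH isαH))
    (subst (γGH ≤_) (*-comm (n G) γH) (γ×≤n*γ G H noIsolatedG isγGH isγH))
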